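{- Let $G=(V,E)$ be a $3$-edge-connected multigraph and $(H,\phi,\psi)$ a cut tree of $G$ as defined below. For an edge $e=(u,v)\in E$, let $l(e)$ be the set of all $3$-edge-cuts of $G$ containing $e$. Then $\phi(l(e))$ is exactly the set of edges of the path in $H$ between $\psi(u)$ and $\psi(v)$.
   Context: A $3$-edge-connected graph is connected and stays connected after deleting any at most $2$ edges; a $3$-edge-cut is a set of $3$ edges whose removal disconnects $G$; $\mathcal{C}$ is the set of all $3$-edge-cuts (for each $c\in\mathcal{C}$, $G\setminus c$ has exactly two components). A cut tree of $G$ is a tree $H=(U,F)$ with a bijection $\phi:\mathcal{C}\to F$ and a map $\psi:V\to U$ such that for every $c\in\mathcal{C}$ splitting $V$ into the two components' vertex sets $V_1,V_2$, removing $\phi(c)$ splits $U$ into $U_1,U_2$ with $\psi^{ -1}(U_1)=V_1$ and $\psi^{ -1}(U_2)=V_2$. -}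

module Defs where

open import Data.Nat using (ℕ; _≤_)
open import Data.Fin using (Fin)
open import Data.Fin.Subset using (Subset; _∈_; _∉_; ∣_∣)
open import Data.Product using (Σ; ∃; _×_; _,_; proj₁; proj₂)
open import Data.Sum using (_⊎_)
open import Data.List using (List; []; _∷_)
open import Data.List.Relation.Unary.Unique.Propositional using (Unique)
open import Relation.Binary.PropositionalEquality using (_≡_; _≢_)
open import Relation.Nullary using (¬_)
open import Function.Bundles using (_⇔_)

record Multigraph : Set where
  constructor mkGraph
  field
    nV   : ℕ
    nE   : ℕ
    ends : Fin nE → Fin nV × Fin nV

open Multigraph public

Joins : (G : Multigraph) → Fin (nE G) → Fin (nV G) → Fin (nV G) → Set
Joins G g x z = (ends G g ≡ (x , z)) ⊎ (ends G g ≡ (z , x))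

data Walk (G : Multigraph) (ok : Fin (nE G) → Set) (x : Fin (nV G)) : Fin (nV G) → Set where
  here : Walk G ok x x
  step : ∀ {z y} (g : Fin (nE G)) → ok g → Joins G g x z → Walk G ok z y → Walk G ok x y

walkVertices : ∀ {G ok x y} → Walk G ok x y → List (Fin (nV G))
walkVertices {x = x} here = x ∷ []
walkVertices {x = x} (step g _ _ w) = x ∷ walkVertices w

walkEdges : ∀ {G ok x y} → Walk G ok x y → List (Fin (nE G))
walkEdges here = []
walkEdges (step g _ _ w) = g ∷ walkEdges w

IsPath : ∀ {G ok x y} → Walk G ok x y → Set
IsPath w = Unique (walkVertices w)

AllEdges : ∀ {A : Set} → A → Set
AllEdges _ = Data.Unit.⊤
  where import Data.Unit

ReachWithout : (G : Multigraph) → Subset (nE G) → Fin (nV G) → Fin (nV G) → Set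
ReachWithout G S x y = Walk G (λ g → g ∉ S) x y

ConnectedWithout : (G : Multigraph) → Subset (nE G) → Set
ConnectedWithout G S = ∀ x y → ReachWithout G S x y

Connected : Multigraph → Set
Connected G = ∀ x y → Walk G AllEdges x y

ThreeEdgeConnected : Multigraph → Set
ThreeEdgeConnected G = Connected G × (∀ (S : Subset (nE G)) → ∣ S ∣ ≤ 2 → ConnectedWithout G S)

IsThreeCut : (G : Multigraph) → Subset (nE G) → Set
IsThreeCut G c = (∣ c ∣ ≡ 3) × ¬ ConnectedWithout G c

ReachWithoutEdge : (H : Multigraph) → Fin (nE H) → Fin (nV H) → Fin (nV H) → Set
ReachWithoutEdge H f x y = Walk H (λ g → g ≢ f) x y

-- A tree: connected, and acyclic (every edge is a bridge: deleting it
-- disconnects its endpoints; in particular there are no loops).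
IsTree : Multigraph → Set
IsTree H = Connected H × (∀ (f : Fin (nE H)) → ¬ ReachWithoutEdge H f (proj₁ (ends H f)) (proj₂ (ends H f)))

-- A cut tree (H, φ, ψ) of G.  φ is a bijection from the set of 3-edge-cuts
-- onto the edges of H; it is encoded as a function on all edge subsets which
-- is injective on 3-edge-cuts and whose image of the 3-edge-cuts is all of F.
record CutTree (G : Multigraph) : Set₁ where
  field
    H    : Multigraph
    tree : IsTree H
    φ    : Subset (nE G) → Fin (nE H)
    ψ    : Fin (nV G) → Fin (nV H)
    φ-inj  : ∀ c c' → IsThreeCut G c → IsThreeCut G c' → φ c ≡ φ c' → c ≡ c'
    φ-surj : ∀ (f : Fin (nE H)) → ∃ λ c → IsThreeCut G c × φ c ≡ f
    -- for every cut c with sides V₁,V₂, removing φ(c) splits U into U₁,U₂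
    -- with ψ⁻¹(U₁) = V₁, ψ⁻¹(U₂) = V₂; i.e. for the side V₁ of any u,
    -- w ∈ V₁ ⇔ ψ w ∈ U₁ (U₁ being the component of ψ u in H - φ(c)).
    split : ∀ c → IsThreeCut G c → ∀ u w →
              ReachWithout G c u w ⇔ ReachWithoutEdge H (φ c) (ψ u) (ψ w)

-- An edge f of the tree H lies on the path between ψ u and ψ v iff deleting f
-- separates ψ u from ψ v, since every edge of a tree is a bridge.  Writing
-- f = φ c, the cut-tree property turns this into: deleting c separates u from v.
-- In a 3-edge-connected graph that happens exactly when e ∈ c: a 3-cut is a
-- minimal cut, so if u and v stayed connected without c, the at most two edges
-- of c other than e would already disconnect G.
module Submission where

open import Defs
open import Data.Fin using (Fin; _≟_)
open import Data.Fin.Subset using (Subset; _∈_; ∣_∣; _-_)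
open import Data.Fin.Subset.Properties using (_∈?_; x∈p∧x≢y⇒x∈p-y; x∈p⇒∣p-x∣<∣p∣)
open import Data.Product using (Σ; ∃; _×_; _,_; proj₁; proj₂)
open import Data.Sum using (inj₁; inj₂)
open import Data.List using (_∷_)
open import Data.List.Membership.Propositional using () renaming (_∈_ to _∈L_)
import Data.List.Membership.DecPropositional as DecMembership
open import Data.List.Relation.Unary.Any using (here; there)
open import Data.List.Relation.Unary.All using ([])
open import Data.List.Relation.Unary.All.Properties using (¬Any⇒All¬; All¬⇒¬Any)
open import Data.List.Relation.Unary.AllPairs using ([]; _∷_)
open import Data.Nat using (suc; _≤_; s≤s⁻¹)
open import Relation.Nullary using (¬_; yes; no; contradiction)
open import Relation.Binary.PropositionalEquality using (_≡_; _≢_; refl; sym; subst)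
open import Function.Bundles using (_⇔_; mk⇔; Equivalence)
open import Function.Base using (_∘_)
open import Function.Construct.Composition using (_⇔-∘_)
open import Function.Related.TypeIsomorphisms using (¬-cong-⇔)

Joins-sym : ∀ {G g x z} → Joins G g x z → Joins G g z x
Joins-sym (inj₁ eq) = inj₂ eq
Joins-sym (inj₂ eq) = inj₁ eq

module _ {G : Multigraph} {ok : Fin (nE G) → Set} where

  open DecMembership (_≟_ {nV G}) using () renaming (_∈?_ to _∈V?_)

  infixr 5 _++ʷ_

  _++ʷ_ : ∀ {x y z} → Walk G ok x y → Walk G ok y z → Walk G ok x z
  here         ++ʷ w′ = w′
  step g o j w ++ʷ w′ = step g o j (w ++ʷ w′)

  reverseʷ : ∀ {x y} → Walk G ok x y → Walk G ok y x
  reverseʷ here           = here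
  reverseʷ (step g o j w) = reverseʷ w ++ʷ step g o (Joins-sym {G} j) here

  reorient : ∀ {g x z x′ z′} → Joins G g x z → Joins G g x′ z′ → Walk G ok x z → Walk G ok x′ z′
  reorient (inj₁ refl) (inj₁ refl) w = w
  reorient (inj₁ refl) (inj₂ refl) w = reverseʷ w
  reorient (inj₂ refl) (inj₁ refl) w = reverseʷ w
  reorient (inj₂ refl) (inj₂ refl) w = w

  source∈walkVertices : ∀ {x y} (w : Walk G ok x y) → x ∈L walkVertices w
  source∈walkVertices here           = here refl
  source∈walkVertices (step _ _ _ _) = here refl

  endpoint∈walkVertices : ∀ {x y g a b} (w : Walk G ok x y) → Joins G g a b →
                          g ∈L walkEdges w → a ∈L walkVertices w
  endpoint∈walkVertices (step g _ j w) j′ (here refl) with j | j′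
  ... | inj₁ refl | inj₁ refl = here refl
  ... | inj₁ refl | inj₂ refl = there (source∈walkVertices w)
  ... | inj₂ refl | inj₁ refl = there (source∈walkVertices w)
  ... | inj₂ refl | inj₂ refl = here refl
  endpoint∈walkVertices (step _ _ _ w) j′ (there m) = there (endpoint∈walkVertices w j′ m)

  dropUntil : ∀ {x z y} (w : Walk G ok z y) → IsPath w → x ∈L walkVertices w →
              Σ (Walk G ok x y) IsPath
  dropUntil here           p       (here refl) = here , [] ∷ []
  dropUntil (step g o j w) p       (here refl) = step g o j w , p
  dropUntil (step g o j w) (_ ∷ p) (there m)   = dropUntil w p m

  eraseLoops : ∀ {x y} → Walk G ok x y → Σ (Walk G ok x y) IsPath
  eraseLoops here = here , [] ∷ []
  eraseLoops {x} (step g o j w) with eraseLoops w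
  ... | w′ , p with x ∈V? walkVertices w′
  ...   | yes x∈w′ = dropUntil w′ p x∈w′
  ...   | no  x∉w′ = step g o j w′ , ¬Any⇒All¬ _ x∉w′ ∷ p

restrictʷ : ∀ {G ok ok′ x y} (w : Walk G ok x y) → (∀ g → g ∈L walkEdges w → ok′ g) → Walk G ok′ x y
restrictʷ here           h = here
restrictʷ (step g _ j w) h = step g (h g (here refl)) j (restrictʷ w (λ g′ m → h g′ (there m)))

separating-edge∈walkEdges : ∀ {H ok x y f} → ¬ ReachWithoutEdge H f x y → (w : Walk H ok x y) → f ∈L walkEdges w
separating-edge∈walkEdges sep here = contradiction here sep
separating-edge∈walkEdges {f = f} sep (step g _ j w) with f ≟ g
... | yes f≡g = here f≡g
... | no  f≢g = there (separating-edge∈walkEdges (sep ∘ step g (f≢g ∘ sym) j) w)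

AllBridges : Multigraph → Set
AllBridges H = ∀ f → ¬ ReachWithoutEdge H f (proj₁ (ends H f)) (proj₂ (ends H f))

module _ {H : Multigraph} (bridges : AllBridges H) where

  bridge-separates : ∀ {f x z} → Joins H f x z → ¬ ReachWithoutEdge H f x z
  bridge-separates {f} j w = bridges f (reorient j (inj₁ refl) w)

  path-edge-separates : ∀ {ok x y f} (P : Walk H ok x y) → IsPath P →
                        f ∈L walkEdges P → ¬ ReachWithoutEdge H f x y
  path-edge-separates {f = f} (step g _ j Q) (x∉Q ∷ Q-path) m W with f ≟ g
  ... | yes refl = bridge-separates j (W ++ʷ reverseʷ (restrictʷ Q f∉Q))
    where
      -- Q never returns to the start vertex, which is an endpoint of f.
      f∉Q : ∀ g → g ∈L walkEdges Q → g ≢ f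
      f∉Q g g∈Q refl = All¬⇒¬Any x∉Q (endpoint∈walkVertices Q j g∈Q)
  path-edge-separates (step g _ j Q) _ (here f≡g) W | no f≢g = f≢g f≡g
  path-edge-separates (step g _ j Q) (_ ∷ Q-path) (there m) W | no f≢g =
    path-edge-separates Q Q-path m (step g (f≢g ∘ sym) (Joins-sym {H} j) here ++ʷ W)

  path-edge⇔separates : ∀ {ok x y} (P : Walk H ok x y) → IsPath P →
                        ∀ f → f ∈L walkEdges P ⇔ (¬ ReachWithoutEdge H f x y)
  path-edge⇔separates P P-path f =
    mk⇔ (path-edge-separates P P-path) (λ sep → separating-edge∈walkEdges sep P)

module _ {G : Multigraph} {c : Subset (nE G)} {e : Fin (nE G)} where

  private
    u = proj₁ (ends G e)
    v = proj₂ (ends G e)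

  bypass : ReachWithout G c u v → ∀ {x y} → ReachWithout G (c - e) x y → ReachWithout G c x y
  bypass r here = here
  bypass r (step g g∉c-e j w) with g ≟ e
  ... | yes refl = reorient (inj₁ refl) j r ++ʷ bypass r w
  ... | no  g≢e  = step g (g∉c-e ∘ λ g∈c → x∈p∧x≢y⇒x∈p-y g∈c g≢e) j (bypass r w)

  cut-edge-separates-ends : ThreeEdgeConnected G → IsThreeCut G c → e ∈ c → ¬ ReachWithout G c u v
  cut-edge-separates-ends (_ , robust) (∣c∣≡3 , disconnects) e∈c r =
    disconnects λ x y → bypass r (robust (c - e) ∣c-e∣≤2 x y)
    where
      ∣c-e∣≤2 : ∣ c - e ∣ ≤ 2
      ∣c-e∣≤2 = s≤s⁻¹ (subst (suc ∣ c - e ∣ ≤_) ∣c∣≡3 (x∈p⇒∣p-x∣<∣p∣ e∈c))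

  separates-ends⇒∈ : ¬ ReachWithout G c u v → e ∈ c
  separates-ends⇒∈ sep with e ∈? c
  ... | yes e∈c = e∈c
  ... | no  e∉c = contradiction (step e e∉c (inj₁ refl) here) sep

  ∈cut⇔separates-ends : ThreeEdgeConnected G → IsThreeCut G c → e ∈ c ⇔ (¬ ReachWithout G c u v)
  ∈cut⇔separates-ends tec cut = mk⇔ (cut-edge-separates-ends tec cut) separates-ends⇒∈

lemma6p5 : (G : Multigraph) → ThreeEdgeConnected G → (T : CutTree G) → (e : Fin (nE G)) →
    Σ (Walk (CutTree.H T) AllEdges (CutTree.ψ T (proj₁ (ends G e))) (CutTree.ψ T (proj₂ (ends G e)))) λ P →
      IsPath P × (∀ (f : Fin (nE (CutTree.H T))) →
        (f ∈L walkEdges P) ⇔ (∃ λ c → IsThreeCut G c × e ∈ c × CutTree.φ T c ≡ f))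
lemma6p5 G tec T e = P , P-path , λ f → mk⇔ (cut-of-path-edge f) path-edge-of-cut
  where
    open CutTree T
    u = proj₁ (ends G e)
    v = proj₂ (ends G e)

    Separates : Fin (nE H) → Set
    Separates f = ¬ ReachWithoutEdge H f (ψ u) (ψ v)

    P = proj₁ (eraseLoops (proj₁ tree (ψ u) (ψ v)))
    P-path = proj₂ (eraseLoops (proj₁ tree (ψ u) (ψ v)))

    on-P⇔separates : ∀ f → f ∈L walkEdges P ⇔ Separates f
    on-P⇔separates = path-edge⇔separates (proj₂ tree) P P-path

    ∈cut⇔separates : ∀ c → IsThreeCut G c → e ∈ c ⇔ Separates (φ c)
    ∈cut⇔separates c cut = ¬-cong-⇔ (split c cut u v) ⇔-∘ ∈cut⇔separates-ends tec cut

    cut-of-path-edge : ∀ f → f ∈L walkEdges P → ∃ λ c → IsThreeCut G c × e ∈ c × φ c ≡ f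
    cut-of-path-edge f f∈P with φ-surj f
    ... | c , cut , refl =
      c , cut , Equivalence.from (∈cut⇔separates c cut) (Equivalence.to (on-P⇔separates (φ c)) f∈P) , refl

    path-edge-of-cut : ∀ {f} → (∃ λ c → IsThreeCut G c × e ∈ c × φ c ≡ f) → f ∈L walkEdges P
    path-edge-of-cut (c , cut , e∈c , refl) =
      Equivalence.from (on-P⇔separates (φ c)) (Equivalence.to (∈cut⇔separates c cut) e∈c)
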